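{- Let $r\ge 0$ be an integer. For every integer $n\ge 0$, as polynomial identities in $x$, \[ \prod_{i=0}^{n-1}(x-i^2)=\sum_{k=0}^{n}u_r(n,k)(x+r)^k, \qquad (x+r)^n=\sum_{k=0}^{n}U_r(n,k)\prod_{i=0}^{k-1}(x-i^2). \]
   Context: For a nonnegative integer $r$, the numbers $u_r(n,k)$ and $U_r(n,k)$ ($n,k\ge 0$ integers) are defined by the recurrences $u_r(n,k)=u_r(n-1,k-1)-((n-1)^2+r)\,u_r(n-1,k)$ and $U_r(n,k)=U_r(n-1,k-1)+(k^2+r)\,U_r(n-1,k)$ for $n\ge k\ge 1$, with initial values $u_r(n,0)=(-1)^n\prod_{i=0}^{n-1}(i^2+r)$, $U_r(n,0)=r^n$ (with $0^0=1$), $u_r(0,k)=U_r(0,k)=\delta_{k0}$, and $u_r(n,k)=U_r(n,k)=0$ whenever $k>n$. Empty products equal $1$. -}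

module Defs where

open import Level using (Level)
open import Data.Nat as ℕ using (ℕ; zero; suc)
open import Data.Integer as ℤ using (ℤ; +_; -[1+_])
open import Algebra.Bundles using (CommutativeRing)

u : ℕ → ℕ → ℕ → ℤ
u r zero zero = ℤ.+ 1
u r zero (suc k) = ℤ.+ 0
u r (suc n) zero = ℤ.- ((ℤ.+ (n ℕ.* n ℕ.+ r)) ℤ.* u r n zero)
u r (suc n) (suc k) = u r n k ℤ.- (ℤ.+ (n ℕ.* n ℕ.+ r)) ℤ.* u r n (suc k)

U : ℕ → ℕ → ℕ → ℕ
U r zero zero = 1
U r zero (suc k) = 0
U r (suc n) zero = r ℕ.^ suc n
U r (suc n) (suc k) = U r n k ℕ.+ (suc k ℕ.* suc k ℕ.+ r) ℕ.* U r n (suc k)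

module InRing {c ℓ : Level} (R : CommutativeRing c ℓ) where
  open CommutativeRing R

  natR : ℕ → Carrier
  natR zero = 0#
  natR (suc n) = 1# + natR n

  intR : ℤ → Carrier
  intR (+ n) = natR n
  intR -[1+ n ] = - (1# + natR n)

  pow : Carrier → ℕ → Carrier
  pow x zero = 1#
  pow x (suc n) = x * pow x n

  prod : ℕ → (ℕ → Carrier) → Carrier
  prod zero f = 1#
  prod (suc n) f = prod n f * f n

  -- ∑_{k=0}^{n} f k  (note: n+1 terms)
  sumTo : ℕ → (ℕ → Carrier) → Carrier
  sumTo zero f = f 0
  sumTo (suc n) f = sumTo n f + f (suc n)

  fallSq : Carrier → ℕ → Carrier
  fallSq x n = prod n (λ i → x - natR (i ℕ.* i))

-- Put y = x + r and a_i = i² + r, so that x − i² = y − a_i.  In the basis of powers of y,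
-- multiplying by y − a_n transforms coordinates exactly as the recurrence for u; in the basis
-- e_k = ∏_{i<k} (x − i²) one has y e_k = e_{k+1} + a_k e_k, so multiplying by y transforms
-- coordinates exactly as the recurrence for U.
module Submission where

open import Defs
open import Level using (Level)
open import Data.Nat using (ℕ)
open import Data.Product using (_×_)
open import Algebra.Bundles using (CommutativeRing)

open import Data.Nat as ℕ using (zero; suc; _<_; s≤s)
import Data.Nat.Properties as ℕ
open import Data.Integer as ℤ using (+_; -[1+_]; _⊖_)
import Data.Integer.Properties as ℤ
open import Data.Product using (_,_)
open import Relation.Binary.PropositionalEquality as ≡ using (_≡_)

u-above-diagonal : ∀ r {n k} → n < k → u r n k ≡ + 0
u-above-diagonal r {zero}  {suc k} _ = ≡.refl
u-above-diagonal r {suc n} {suc k} (s≤s n<k)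
  rewrite u-above-diagonal r n<k | u-above-diagonal r (ℕ.m≤n⇒m≤1+n n<k)
        | ℤ.*-zeroʳ (+ (n ℕ.* n ℕ.+ r)) = ≡.refl

U-above-diagonal : ∀ r {n k} → n < k → U r n k ≡ 0
U-above-diagonal r {zero}  {suc k} _ = ≡.refl
U-above-diagonal r {suc n} {suc k} (s≤s n<k)
  rewrite U-above-diagonal r n<k | U-above-diagonal r (ℕ.m≤n⇒m≤1+n n<k)
        | ℕ.*-zeroʳ (suc k ℕ.* suc k ℕ.+ r) = ≡.refl

U[n,0]≡r^n : ∀ r n → U r n 0 ≡ r ℕ.^ n
U[n,0]≡r^n r zero    = ≡.refl
U[n,0]≡r^n r (suc n) = ≡.refl

module _ {c ℓ : Level} (R : CommutativeRing c ℓ) where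
  open CommutativeRing R
  open InRing R
  open import Algebra.Properties.Ring ring using (-‿distribˡ-*; -‿involutive; -0#≈0#)
  open import Algebra.Properties.Group +-group using (//-rightDividesˡ)
  open import Algebra.Properties.AbelianGroup +-abelianGroup using (⁻¹-∙-comm)
  open import Algebra.Properties.CommutativeSemigroup +-commutativeSemigroup
    using (interchange) renaming (x∙yz≈y∙xz to x+yz≈y+xz)
  open import Algebra.Properties.CommutativeSemigroup *-commutativeSemigroup
    using () renaming (x∙yz≈y∙xz to x*yz≈y*xz; x∙yz≈yx∙z to x*yz≈yx*z)
  open import Relation.Binary.Reasoning.Setoid setoid

  [x+z]-[y+z]≈x-y : ∀ x y z → (x + z) - (y + z) ≈ x - y
  [x+z]-[y+z]≈x-y x y z = begin
    (x + z) + - (y + z)     ≈⟨ +-congˡ (⁻¹-∙-comm y z) ⟨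
    (x + z) + (- y + - z)   ≈⟨ interchange x z (- y) (- z) ⟩
    (x + - y) + (z + - z)   ≈⟨ +-congˡ (-‿inverseʳ z) ⟩
    (x + - y) + 0#          ≈⟨ +-identityʳ (x - y) ⟩
    x - y                   ∎

  natR-+ : ∀ m n → natR (m ℕ.+ n) ≈ natR m + natR n
  natR-+ zero    n = sym (+-identityˡ (natR n))
  natR-+ (suc m) n = trans (+-congˡ (natR-+ m n)) (sym (+-assoc 1# (natR m) (natR n)))

  natR-* : ∀ m n → natR (m ℕ.* n) ≈ natR m * natR n
  natR-* zero    n = sym (zeroˡ (natR n))
  natR-* (suc m) n = begin
    natR (n ℕ.+ m ℕ.* n)          ≈⟨ natR-+ n (m ℕ.* n) ⟩
    natR n + natR (m ℕ.* n)       ≈⟨ +-cong (sym (*-identityˡ (natR n))) (natR-* m n) ⟩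
    1# * natR n + natR m * natR n ≈⟨ distribʳ (natR n) 1# (natR m) ⟨
    (1# + natR m) * natR n        ∎

  intR-⊖ : ∀ m n → intR (m ⊖ n) ≈ natR m - natR n
  intR-⊖ zero    zero    = sym (trans (+-congˡ -0#≈0#) (+-identityʳ 0#))
  intR-⊖ (suc m) zero    = sym (trans (+-congˡ -0#≈0#) (+-identityʳ (natR (suc m))))
  intR-⊖ zero    (suc n) = sym (+-identityˡ (- natR (suc n)))
  intR-⊖ (suc m) (suc n) rewrite ℤ.[1+m]⊖[1+n]≡m⊖n m n = begin
    intR (m ⊖ n)                  ≈⟨ intR-⊖ m n ⟩
    natR m - natR n               ≈⟨ [x+z]-[y+z]≈x-y (natR m) (natR n) 1# ⟨
    (natR m + 1#) - (natR n + 1#) ≈⟨ +-cong (+-comm (natR m) 1#) (-‿cong (+-comm (natR n) 1#)) ⟩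
    natR (suc m) - natR (suc n)   ∎

  intR-neg : ∀ i → intR (ℤ.- i) ≈ - intR i
  intR-neg (+ zero)  = sym -0#≈0#
  intR-neg (+ suc n) = refl
  intR-neg -[1+ n ]  = sym (-‿involutive (natR (suc n)))

  intR-+ : ∀ i j → intR (i ℤ.+ j) ≈ intR i + intR j
  intR-+ (+ m)    (+ n)    = natR-+ m n
  intR-+ (+ m)    -[1+ n ] = intR-⊖ m (suc n)
  intR-+ -[1+ m ] (+ n)    = trans (intR-⊖ n (suc m)) (+-comm (natR n) (- natR (suc m)))
  intR-+ -[1+ m ] -[1+ n ] = begin
    - (1# + (1# + natR (m ℕ.+ n)))       ≈⟨ -‿cong (+-congˡ (+-congˡ (natR-+ m n))) ⟩
    - (1# + (1# + (natR m + natR n)))    ≈⟨ -‿cong (+-congˡ (x+yz≈y+xz (natR m) 1# (natR n))) ⟨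
    - (1# + (natR m + (1# + natR n)))    ≈⟨ -‿cong (+-assoc 1# (natR m) (1# + natR n)) ⟨
    - ((1# + natR m) + (1# + natR n))    ≈⟨ ⁻¹-∙-comm (1# + natR m) (1# + natR n) ⟨
    - (1# + natR m) + - (1# + natR n)    ∎

  intR-ℕ* : ∀ m i → intR (+ m ℤ.* i) ≈ natR m * intR i
  intR-ℕ* zero    i rewrite ℤ.*-zeroˡ i = sym (zeroˡ (intR i))
  intR-ℕ* (suc m) i = begin
    intR (+ suc m ℤ.* i)                ≡⟨ ≡.cong intR (ℤ.*-distribʳ-+ i (+ 1) (+ m)) ⟩
    intR (+ 1 ℤ.* i ℤ.+ + m ℤ.* i)      ≈⟨ intR-+ (+ 1 ℤ.* i) (+ m ℤ.* i) ⟩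
    intR (+ 1 ℤ.* i) + intR (+ m ℤ.* i) ≡⟨ ≡.cong (λ j → intR j + intR (+ m ℤ.* i)) (ℤ.*-identityˡ i) ⟩
    intR i + intR (+ m ℤ.* i)           ≈⟨ +-cong (sym (*-identityˡ (intR i))) (intR-ℕ* m i) ⟩
    1# * intR i + natR m * intR i       ≈⟨ distribʳ (intR i) 1# (natR m) ⟨
    natR (suc m) * intR i               ∎

  intR-neg-ℕ* : ∀ m i → intR (ℤ.- (+ m ℤ.* i)) ≈ - natR m * intR i
  intR-neg-ℕ* m i = trans (intR-neg (+ m ℤ.* i)) (trans (-‿cong (intR-ℕ* m i)) (-‿distribˡ-* (natR m) (intR i)))

  sumTo-cong : ∀ n {f g : ℕ → Carrier} → (∀ k → f k ≈ g k) → sumTo n f ≈ sumTo n g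
  sumTo-cong zero    f≈g = f≈g 0
  sumTo-cong (suc n) f≈g = +-cong (sumTo-cong n f≈g) (f≈g (suc n))

  sumTo-+ : ∀ n (f g : ℕ → Carrier) → sumTo n (λ k → f k + g k) ≈ sumTo n f + sumTo n g
  sumTo-+ zero    f g = refl
  sumTo-+ (suc n) f g = trans (+-congʳ (sumTo-+ n f g)) (interchange _ _ _ _)

  *-distribˡ-sumTo : ∀ n a (f : ℕ → Carrier) → a * sumTo n f ≈ sumTo n (λ k → a * f k)
  *-distribˡ-sumTo zero    a f = refl
  *-distribˡ-sumTo (suc n) a f = trans (distribˡ a _ _) (+-congʳ (*-distribˡ-sumTo n a f))

  sumTo-suc : ∀ n (f : ℕ → Carrier) → sumTo (suc n) f ≈ f 0 + sumTo n (λ k → f (suc k))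
  sumTo-suc zero    f = refl
  sumTo-suc (suc n) f = trans (+-congʳ (sumTo-suc n f)) (+-assoc _ _ _)

  sumTo-reindex : ∀ n (f : ℕ → Carrier) → f (suc n) ≈ 0# →
                  sumTo n f ≈ f 0 + sumTo n (λ k → f (suc k))
  sumTo-reindex n f fₙ₊₁≈0 = begin
    sumTo n f             ≈⟨ +-identityʳ (sumTo n f) ⟨
    sumTo n f + 0#        ≈⟨ +-congˡ fₙ₊₁≈0 ⟨
    sumTo (suc n) f       ≈⟨ sumTo-suc n f ⟩
    f 0 + sumTo n (λ k → f (suc k)) ∎

  -- The coordinates of z * ∑ c k * b k when z * b k ≈ b (k+1) + β k * b k.
  mulCoeffs : (β c : ℕ → Carrier) → ℕ → Carrier
  mulCoeffs β c zero    = β 0 * c 0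
  mulCoeffs β c (suc k) = c k + β (suc k) * c (suc k)

  *-sumTo-basis : ∀ {z} {b β : ℕ → Carrier} → (∀ k → z * b k ≈ b (suc k) + β k * b k) →
                  ∀ n {c : ℕ → Carrier} → c (suc n) ≈ 0# →
                  z * sumTo n (λ k → c k * b k) ≈ sumTo (suc n) (λ k → mulCoeffs β c k * b k)
  *-sumTo-basis {z} {b} {β} zb≈ n {c} cₙ₊₁≈0 = begin
    z * sumTo n (λ k → c k * b k)                            ≈⟨ *-distribˡ-sumTo n z _ ⟩
    sumTo n (λ k → z * (c k * b k))                          ≈⟨ sumTo-cong n term ⟩
    sumTo n (λ k → c k * b (suc k) + m k)                    ≈⟨ sumTo-+ n _ m ⟩
    S + sumTo n m                                            ≈⟨ +-congˡ (sumTo-reindex n m mₙ₊₁≈0) ⟩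
    S + (m 0 + sumTo n (λ k → m (suc k)))                    ≈⟨ x+yz≈y+xz S (m 0) _ ⟩
    m 0 + (S + sumTo n (λ k → m (suc k)))                    ≈⟨ +-congˡ (sumTo-+ n _ _) ⟨
    m 0 + sumTo n (λ k → c k * b (suc k) + m (suc k))        ≈⟨ +-congˡ (sumTo-cong n λ k →
                                                                 distribʳ (b (suc k)) _ _) ⟨
    m 0 + sumTo n (λ k → mulCoeffs β c (suc k) * b (suc k))  ≈⟨ sumTo-suc n _ ⟨
    sumTo (suc n) (λ k → mulCoeffs β c k * b k)              ∎
    where
    m : ℕ → Carrier
    m k = (β k * c k) * b k

    S : Carrier
    S = sumTo n (λ k → c k * b (suc k))

    term : ∀ k → z * (c k * b k) ≈ c k * b (suc k) + m k
    term k = begin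
      z * (c k * b k)                    ≈⟨ x*yz≈y*xz z (c k) (b k) ⟩
      c k * (z * b k)                    ≈⟨ *-congˡ (zb≈ k) ⟩
      c k * (b (suc k) + β k * b k)      ≈⟨ distribˡ (c k) _ _ ⟩
      c k * b (suc k) + c k * (β k * b k) ≈⟨ +-congˡ (x*yz≈yx*z (c k) (β k) (b k)) ⟩
      c k * b (suc k) + m k              ∎

    mₙ₊₁≈0 : m (suc n) ≈ 0#
    mₙ₊₁≈0 = trans (*-congʳ (trans (*-congˡ cₙ₊₁≈0) (zeroʳ _))) (zeroˡ _)

  module Expansions (r : ℕ) (x : Carrier) where
    y : Carrier
    y = x + natR r

    sqr+r : ℕ → Carrier
    sqr+r i = natR (i ℕ.* i ℕ.+ r)

    x-m≈y-[m+r] : ∀ m → x - natR m ≈ y - natR (m ℕ.+ r)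
    x-m≈y-[m+r] m = begin
      x - natR m                        ≈⟨ [x+z]-[y+z]≈x-y x (natR m) (natR r) ⟨
      (x + natR r) - (natR m + natR r)  ≈⟨ +-congˡ (-‿cong (natR-+ m r)) ⟨
      y - natR (m ℕ.+ r)                ∎

    *-pow-basis : ∀ i k → (x - natR (i ℕ.* i)) * pow y k ≈ pow y (suc k) + - sqr+r i * pow y k
    *-pow-basis i k = trans (*-congʳ (x-m≈y-[m+r] (i ℕ.* i))) (distribʳ (pow y k) y (- sqr+r i))

    *-fallSq-basis : ∀ k → y * fallSq x k ≈ fallSq x (suc k) + sqr+r k * fallSq x k
    *-fallSq-basis k = begin
      y * e                            ≈⟨ *-comm y e ⟩
      e * y                            ≈⟨ *-congˡ (//-rightDividesˡ (sqr+r k) y) ⟨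
      e * ((y - sqr+r k) + sqr+r k)    ≈⟨ distribˡ e (y - sqr+r k) (sqr+r k) ⟩
      e * (y - sqr+r k) + e * sqr+r k  ≈⟨ +-cong (*-congˡ (x-m≈y-[m+r] (k ℕ.* k))) (*-comm (sqr+r k) e) ⟨
      e * (x - natR (k ℕ.* k)) + sqr+r k * e ∎
      where
      e : Carrier
      e = fallSq x k

    u-mulCoeffs : ∀ n k → mulCoeffs (λ _ → - sqr+r n) (λ j → intR (u r n j)) k ≈ intR (u r (suc n) k)
    u-mulCoeffs n zero    = sym (intR-neg-ℕ* (n ℕ.* n ℕ.+ r) (u r n 0))
    u-mulCoeffs n (suc k) = sym (trans (intR-+ (u r n k) _) (+-congˡ (intR-neg-ℕ* (n ℕ.* n ℕ.+ r) _)))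

    U-mulCoeffs : ∀ n k → mulCoeffs sqr+r (λ j → natR (U r n j)) k ≈ natR (U r (suc n) k)
    U-mulCoeffs n zero    rewrite U[n,0]≡r^n r n = sym (natR-* r (r ℕ.^ n))
    U-mulCoeffs n (suc k) = sym (trans (natR-+ (U r n k) _) (+-congˡ (natR-* (suc k ℕ.* suc k ℕ.+ r) (U r n (suc k)))))

    fallSq-in-powers : ∀ n → fallSq x n ≈ sumTo n (λ k → intR (u r n k) * pow y k)
    fallSq-in-powers zero    = sym (trans (*-identityʳ _) (+-identityʳ 1#))
    fallSq-in-powers (suc n) = begin
      fallSq x n * (x - natR (n ℕ.* n))                           ≈⟨ *-comm _ _ ⟩
      (x - natR (n ℕ.* n)) * fallSq x n                           ≈⟨ *-congˡ (fallSq-in-powers n) ⟩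
      (x - natR (n ℕ.* n)) * sumTo n (λ k → intR (u r n k) * pow y k)
        ≈⟨ *-sumTo-basis (*-pow-basis n) n (reflexive (≡.cong intR (u-above-diagonal r (ℕ.n<1+n n)))) ⟩
      sumTo (suc n) (λ k → mulCoeffs _ (λ j → intR (u r n j)) k * pow y k)
        ≈⟨ sumTo-cong (suc n) (λ k → *-congʳ (u-mulCoeffs n k)) ⟩
      sumTo (suc n) (λ k → intR (u r (suc n) k) * pow y k)        ∎

    pow-in-fallSq : ∀ n → pow y n ≈ sumTo n (λ k → natR (U r n k) * fallSq x k)
    pow-in-fallSq zero    = sym (trans (*-identityʳ _) (+-identityʳ 1#))
    pow-in-fallSq (suc n) = begin
      y * pow y n                                                 ≈⟨ *-congˡ (pow-in-fallSq n) ⟩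
      y * sumTo n (λ k → natR (U r n k) * fallSq x k)
        ≈⟨ *-sumTo-basis *-fallSq-basis n (reflexive (≡.cong natR (U-above-diagonal r (ℕ.n<1+n n)))) ⟩
      sumTo (suc n) (λ k → mulCoeffs sqr+r (λ j → natR (U r n j)) k * fallSq x k)
        ≈⟨ sumTo-cong (suc n) (λ k → *-congʳ (U-mulCoeffs n k)) ⟩
      sumTo (suc n) (λ k → natR (U r (suc n) k) * fallSq x k)     ∎

mainTheorem3 : ∀ {c ℓ : Level} (R : CommutativeRing c ℓ) (r n : ℕ) (x : CommutativeRing.Carrier R) →
    let open CommutativeRing R
        open InRing R
    in (fallSq x n ≈ sumTo n (λ k → intR (u r n k) * pow (x + natR r) k))
       × (pow (x + natR r) n ≈ sumTo n (λ k → natR (U r n k) * fallSq x k))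
mainTheorem3 R r n x = fallSq-in-powers n , pow-in-fallSq n
  where open Expansions R r x
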